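{- Let $l_1 \le m_1 < l_2 \le m_2$ be positive integers and $k$ a positive integer. Let \[ h^{(2)}(l_1,m_1,l_2,m_2) = \#\{X \subseteq [l_1,m_1]\cup[l_2,m_2] :\ l_1, l_2 \in X \text{ and } \gcd(X) = 1\}, \] \[ h^{(2)}_k(l_1,m_1,l_2,m_2) = \#\{X \subseteq [l_1,m_1]\cup[l_2,m_2] :\ l_1, l_2 \in X,\ \#X = k, \text{ and } \gcd(X) = 1\}. \] Then (a) $\displaystyle h^{(2)}(l_1,m_1,l_2,m_2) = \sum_{d \mid (l_1,l_2)} \mu(d)\, 2^{\lfloor m_1/d\rfloor + \lfloor m_2/d\rfloor - (l_1+l_2)/d}$; (b) $\displaystyle h^{(2)}_k(l_1,m_1,l_2,m_2) = \sum_{d \mid (l_1,l_2)} \mu(d) \binom{\lfloor m_1/d\rfloor + \lfloor m_2/d\rfloor - (l_1+l_2)/d}{k-2}$.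
   Context: For positive integers $l \le m$, $[l,m] = \{l, l+1, \ldots, m\}$. $\mu$ is the Möbius function, $\lfloor x\rfloor$ is the floor of $x$, $(l_1,l_2)=\gcd(l_1,l_2)$, and $\gcd(X)$ is the greatest common divisor of the elements of a nonempty finite set $X$ of positive integers. The sums are over positive common divisors $d$ of $l_1$ and $l_2$. A binomial coefficient $\binom{a}{b}$ with $b<0$ is $0$. -}

module Defs where

open import Data.Nat using (ℕ; zero; suc; _+_; _*_; _∸_; _^_; _≤_; _<_; NonZero)
open import Data.Nat.Divisibility using (_∣_; _∣?_)
open import Data.Nat.GCD using (gcd)
open import Data.Nat.Primality using (Prime; prime?)
open import Data.Nat.Combinatorics using (_C_)
open import Data.Nat.DivMod using (_/_)
open import Data.Integer as ℤ using (ℤ; +_; -[1+_])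
open import Data.List using (List; []; _∷_; map; _++_; upTo; filter; length; foldr)
open import Data.List.Membership.DecPropositional (Data.Nat._≟_) using (_∈_; _∈?_)
open import Relation.Nullary using (¬_; Dec; yes; no)
open import Relation.Nullary.Decidable using (_×-dec_; ¬?)
open import Data.Product using (_×_)
open import Data.List.Relation.Unary.All using (All; all?)
open import Data.Bool using (if_then_else_)

range : ℕ → ℕ → List ℕ
range l m = map (λ i → l + i) (upTo (suc m ∸ l))

-- all sublists of a list; for a list of distinct elements these are
-- exactly the subsets of its underlying set, each listed once
sublists : {A : Set} → List A → List (List A)
sublists [] = [] ∷ []
sublists (x ∷ xs) = map (x ∷_) (sublists xs) ++ sublists xs

gcdSet : List ℕ → ℕ
gcdSet = foldr gcd 0

squarefree? : (d : ℕ) → Dec (All (λ k → ¬ (k * k ∣ d)) (range 2 d))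
squarefree? d = all? (λ k → ¬? (k * k ∣? d)) (range 2 d)

ω : ℕ → ℕ
ω d = length (filter (λ p → prime? p ×-dec (p ∣? d)) (range 1 d))

μ : ℕ → ℤ
μ d with squarefree? d
... | yes _ = (ℤ.- (+ 1)) ℤ.^ ω d
... | no _  = + 0

sumCommonDiv : ℕ → ℕ → (ℕ → ℤ) → ℤ
sumCommonDiv a b f =
  foldr (λ d acc → f d ℤ.+ acc) (+ 0)
        (filter (λ d → (d ∣? a) ×-dec (d ∣? b)) (range 1 (gcd a b)))

binomℤ : ℕ → ℤ → ℕ
binomℤ n (+ j) = n C j
binomℤ n -[1+ _ ] = 0

-- the family of subsets X ⊆ [l₁,m₁] ∪ [l₂,m₂] with l₁, l₂ ∈ X, gcd(X) = 1
-- (m₁ < l₂ makes the two intervals disjoint, so sublists of the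
--  concatenated range enumerate each subset exactly once)
goodSets : ℕ → ℕ → ℕ → ℕ → List (List ℕ)
goodSets l₁ m₁ l₂ m₂ =
  filter (λ X → (l₁ ∈? X) ×-dec ((l₂ ∈? X) ×-dec (gcdSet X Data.Nat.≟ 1)))
         (sublists (range l₁ m₁ ++ range l₂ m₂))

h2 : ℕ → ℕ → ℕ → ℕ → ℕ
h2 l₁ m₁ l₂ m₂ = length (goodSets l₁ m₁ l₂ m₂)

h2k : ℕ → ℕ → ℕ → ℕ → ℕ → ℕ
h2k l₁ m₁ l₂ m₂ k =
  length (filter (λ X → length X Data.Nat.≟ k) (goodSets l₁ m₁ l₂ m₂))

-- floor division n / d; only ever used with d ≥ 1 (d ranges over positive
-- divisors), the value at d = 0 is an irrelevant convention
_div_ : ℕ → ℕ → ℕ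
n div zero = 0
n div (suc d) = n / suc d

module Submission where

-- Möbius inversion turns the condition gcd X = 1 into Σ_{d ∣ gcd X} μ(d). When l₁, l₂ ∈ X the
-- divisors of gcd X are the common divisors d of l₁ and l₂ that divide every element of X, so
-- swapping the two sums leaves, for each such d, the number of sets X of multiples of d that
-- contain l₁ and l₂. Apart from l₁ and l₂ such an X is an arbitrary subset (for (b): a subset of
-- size k − 2) of the remaining ⌊m₁/d⌋ + ⌊m₂/d⌋ − (l₁ + l₂)/d multiples of d in the two intervals.
-- The identity Σ_{d ∣ n} μ(d) = [n = 1] comes from one prime factor p of n: the divisors e·p with
-- p ∤ e contribute μ(e·p) = −μ(e) and cancel the divisors e of n/p with p ∤ e, while μ(e·p) = 0
-- when p ∣ e.

open import Defs
open import Algebra.Bundles using (CommutativeSemiring)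
open import Data.Bool using (true; false; if_then_else_)
open import Data.List using (List; []; _∷_; _++_; _∷ʳ_; [_]; map; filter; foldr; iterate)
open import Data.List.Membership.Propositional using (_∈_)
open import Data.List.Relation.Unary.Any using (here; there)
open import Relation.Nullary using (Dec; yes; no; does; ¬_)
open import Relation.Unary using (Decidable)
import Relation.Binary.PropositionalEquality as ≡

module Sum {c ℓ} (R : CommutativeSemiring c ℓ) where
  open CommutativeSemiring R
  open import Algebra.Properties.CommutativeSemigroup +-commutativeSemigroup using (interchange)

  ∑ : {A : Set} → (A → Carrier) → List A → Carrier
  ∑ f = foldr (λ x s → f x + s) 0#

  module _ {A : Set} where

    ∑-cong : ∀ {f g : A → Carrier} xs → (∀ x → x ∈ xs → f x ≈ g x) → ∑ f xs ≈ ∑ g xs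
    ∑-cong [] _ = refl
    ∑-cong (x ∷ xs) e = +-cong (e x (here ≡.refl)) (∑-cong xs (λ y y∈ → e y (there y∈)))

    ∑-zero : ∀ {f : A → Carrier} xs → (∀ x → x ∈ xs → f x ≈ 0#) → ∑ f xs ≈ 0#
    ∑-zero [] _ = refl
    ∑-zero (x ∷ xs) e = trans (+-cong (e x (here ≡.refl)) (∑-zero xs (λ y y∈ → e y (there y∈)))) (+-identityˡ 0#)

    ∑-++ : ∀ (f : A → Carrier) xs ys → ∑ f (xs ++ ys) ≈ ∑ f xs + ∑ f ys
    ∑-++ f [] ys = sym (+-identityˡ _)
    ∑-++ f (x ∷ xs) ys = trans (+-congˡ (∑-++ f xs ys)) (sym (+-assoc (f x) _ _))

    ∑-∷ʳ : ∀ (f : A → Carrier) xs y → ∑ f (xs ∷ʳ y) ≈ ∑ f xs + f y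
    ∑-∷ʳ f xs y = trans (∑-++ f xs [ y ]) (+-congˡ (+-identityʳ (f y)))

    ∑-+ : ∀ (f g : A → Carrier) xs → ∑ (λ x → f x + g x) xs ≈ ∑ f xs + ∑ g xs
    ∑-+ f g [] = sym (+-identityˡ 0#)
    ∑-+ f g (x ∷ xs) = trans (+-congˡ (∑-+ f g xs)) (interchange (f x) (g x) (∑ f xs) (∑ g xs))

    ∑-*ˡ : ∀ c (f : A → Carrier) xs → ∑ (λ x → c * f x) xs ≈ c * ∑ f xs
    ∑-*ˡ c f [] = sym (zeroʳ c)
    ∑-*ˡ c f (x ∷ xs) = trans (+-congˡ (∑-*ˡ c f xs)) (sym (distribˡ c (f x) _))

    ∑-*ʳ : ∀ c (f : A → Carrier) xs → ∑ (λ x → f x * c) xs ≈ ∑ f xs * c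
    ∑-*ʳ c f [] = sym (zeroˡ c)
    ∑-*ʳ c f (x ∷ xs) = trans (+-congˡ (∑-*ʳ c f xs)) (sym (distribʳ c (f x) _))

    ∑-filter : ∀ {P : A → Set} (P? : Decidable P) (f : A → Carrier) xs →
      ∑ f (filter P? xs) ≈ ∑ (λ x → if does (P? x) then f x else 0#) xs
    ∑-filter P? f [] = refl
    ∑-filter P? f (x ∷ xs) with does (P? x)
    ... | true = +-congˡ (∑-filter P? f xs)
    ... | false = trans (∑-filter P? f xs) (sym (+-identityˡ _))

  ∑-map : ∀ {A B : Set} (f : B → Carrier) (g : A → B) xs → ∑ f (map g xs) ≈ ∑ (λ x → f (g x)) xs
  ∑-map f g [] = refl
  ∑-map f g (x ∷ xs) = +-congˡ (∑-map f g xs)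

  ∑-swap : ∀ {A B : Set} (F : A → B → Carrier) xs ys →
    ∑ (λ x → ∑ (F x) ys) xs ≈ ∑ (λ y → ∑ (λ x → F x y) xs) ys
  ∑-swap F [] ys = sym (∑-zero ys (λ _ _ → refl))
  ∑-swap F (x ∷ xs) ys = trans (+-congˡ (∑-swap F xs ys)) (sym (∑-+ (F x) _ ys))

  ∑-sublists-∷ : ∀ {A : Set} (f : List A → Carrier) x xs →
    ∑ f (sublists (x ∷ xs)) ≈ ∑ (λ ys → f (x ∷ ys)) (sublists xs) + ∑ f (sublists xs)
  ∑-sublists-∷ f x xs =
    trans (∑-++ f (map (x ∷_) (sublists xs)) (sublists xs)) (+-congʳ (∑-map f (x ∷_) (sublists xs)))

-- These are opened only now: their names would clash with the semiring operations opened in Sum.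
open import Data.Nat
  using (ℕ; zero; suc; _+_; _*_; _∸_; _^_; _≤_; _<_; _≟_; z<s; s≤s; NonZero; >-nonZero; >-nonZero⁻¹; nonTrivial⇒n>1)
open import Data.Nat.Properties
open import Data.Nat.Divisibility
open import Data.Nat.DivMod using (_/_; _%_; /-congˡ; m≡m%n+[m/n]*n; m*n/n≡m; m%n<n; m<n⇒m/n≡0; +-distrib-/-∣ʳ; +-distrib-/-∣ˡ)
open import Data.Nat.GCD using (gcd; gcd[m,n]∣m; gcd[m,n]∣n; gcd-greatest)
open import Data.Nat.Coprimality using (Coprime; coprime-divisor)
open import Data.Nat.Primality
  using (Prime; prime?; prime⇒irreducible; prime⇒nonZero; prime⇒nonTrivial; euclidsLemma; ¬prime[1]; productOfPrimes≥1)
open import Data.Nat.Primality.Factorisation using (factorise)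
open import Data.Nat.ListAction using (product)
open import Data.Nat.Combinatorics using (_C_; nCk+nC[k+1]≡[n+1]C[k+1])
open import Algebra.Properties.CommutativeSemigroup *-commutativeSemigroup using (x∙yz≈y∙xz)
import Algebra.Properties.CommutativeSemigroup +-commutativeSemigroup as +-CS
open import Data.Integer as ℤ using (ℤ; +_)
import Data.Integer.Properties as ℤP
open import Data.List using (applyUpTo; length)
import Data.List.Properties as List
open import Data.List.Membership.DecPropositional _≟_ using (_∈?_)
open import Data.List.Membership.Propositional.Properties using (∈-filter⁻; ∈-++⁻; ∈-map⁻)
open import Data.List.Relation.Unary.All as All using (All; []; _∷_; all?)
open import Data.Product using (_×_; _,_; proj₁; proj₂)
open import Data.Sum using (inj₁; inj₂; [_,_]′)
open import Data.Empty using (⊥-elim)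
open import Data.Bool.Properties using (if-cong-then; if-eta)
open import Function using (id; _∘_)
open import Function.Bundles using (_⇔_; mk⇔)
open import Relation.Nullary.Decidable using (_×-dec_; ¬?; does-⇔; map′)
open import Relation.Binary.PropositionalEquality using (_≡_; _≢_; refl; sym; trans; cong; cong₂; subst; module ≡-Reasoning)

module Σℕ = Sum +-*-commutativeSemiring
module Σℤ = Sum ℤP.+-*-commutativeSemiring

private variable
  P Q : Set

𝟙 : Dec P → ℕ
𝟙 P? = if does P? then 1 else 0

if-yes : ∀ {a} {A : Set a} (P? : Dec P) {x y : A} → P → (if does P? then x else y) ≡ x
if-yes (yes _) _ = refl
if-yes (no ¬p) p = ⊥-elim (¬p p)

if-no : ∀ {a} {A : Set a} (P? : Dec P) {x y : A} → ¬ P → (if does P? then x else y) ≡ y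
if-no (yes p) ¬p = ⊥-elim (¬p p)
if-no (no _) _ = refl

if-⇔ : ∀ {a} {A : Set a} {x y : A} → P ⇔ Q → (P? : Dec P) (Q? : Dec Q) →
  (if does P? then x else y) ≡ (if does Q? then x else y)
if-⇔ P⇔Q P? Q? = cong (λ b → if b then _ else _) (does-⇔ P⇔Q P? Q?)

𝟙-× : (P? : Dec P) (Q? : Dec Q) → 𝟙 (P? ×-dec Q?) ≡ 𝟙 P? * 𝟙 Q?
𝟙-× (yes _) (yes _) = refl
𝟙-× (yes _) (no _) = refl
𝟙-× (no _) _ = refl

if-split : (P? : Dec P) (x : ℤ) → x ≡ (if does P? then x else + 0) ℤ.+ (if does P? then + 0 else x)
if-split (yes _) x = sym (ℤP.+-identityʳ x)
if-split (no _) x = sym (ℤP.+-identityˡ x)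

-- length is definitionally Σℕ.∑ (λ _ → 1).
length-filter : ∀ {A : Set} {P : A → Set} (P? : Decidable P) xs → length (filter P? xs) ≡ Σℕ.∑ (λ x → 𝟙 (P? x)) xs
length-filter P? xs = Σℕ.∑-filter P? (λ _ → 1) xs

length-filter-filter : ∀ {A : Set} {P Q : A → Set} (P? : Decidable P) (Q? : Decidable Q) xs →
  length (filter Q? (filter P? xs)) ≡ Σℕ.∑ (λ x → 𝟙 (P? x) * 𝟙 (Q? x)) xs
length-filter-filter P? Q? xs =
  trans (length-filter Q? (filter P? xs)) (trans (Σℕ.∑-filter P? _ xs) (Σℕ.∑-cong xs (λ x _ → if-then-0 (P? x))))
  where
  if-then-0 : ∀ {P : Set} (P? : Dec P) {y} → (if does P? then y else 0) ≡ 𝟙 P? * y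
  if-then-0 (yes _) {y} = sym (+-identityʳ y)
  if-then-0 (no _) = refl

𝟙-∈-∷-≢ : ∀ {x y} Y → x ≢ y → 𝟙 (x ∈? y ∷ Y) ≡ 𝟙 (x ∈? Y)
𝟙-∈-∷-≢ {x} {y} Y x≢y =
  if-⇔ (mk⇔ (λ { (here x≡y) → ⊥-elim (x≢y x≡y) ; (there x∈Y) → x∈Y }) there) (x ∈? y ∷ Y) (x ∈? Y)

-- Intervals

iterate-suc-+ : ∀ a m n → iterate suc a (m + n) ≡ iterate suc a m ++ iterate suc (a + m) n
iterate-suc-+ a zero n = cong (λ b → iterate suc b n) (sym (+-identityʳ a))
iterate-suc-+ a (suc m) n = cong (a ∷_) (trans (iterate-suc-+ (suc a) m n)
  (cong (λ b → iterate suc (suc a) m ++ iterate suc b n) (sym (+-suc a m))))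

iterate-suc-∷ʳ : ∀ a n → iterate suc a (suc n) ≡ iterate suc a n ∷ʳ (a + n)
iterate-suc-∷ʳ a n = trans (cong (iterate suc a) (+-comm 1 n)) (iterate-suc-+ a n 1)

∈-iterate-suc⁻ : ∀ {x} a n → x ∈ iterate suc a n → a ≤ x × x < a + n
∈-iterate-suc⁻ a (suc n) (here refl) = ≤-refl , m<m+n a z<s
∈-iterate-suc⁻ {x} a (suc n) (there x∈) with ∈-iterate-suc⁻ (suc a) n x∈
... | a<x , x<a+n = <⇒≤ a<x , subst (x <_) (sym (+-suc a n)) x<a+n

∈-iterate-suc⁺ : ∀ {x} a n → a ≤ x → x < a + n → x ∈ iterate suc a n
∈-iterate-suc⁺ {x} a zero a≤x x<a+0 = ⊥-elim (<⇒≱ x<a+0 (subst (_≤ x) (sym (+-identityʳ a)) a≤x))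
∈-iterate-suc⁺ {x} a (suc n) a≤x x<a+n with a ≟ x
... | yes refl = here refl
... | no a≢x = there (∈-iterate-suc⁺ (suc a) n (≤∧≢⇒< a≤x a≢x) (subst (x <_) (+-suc a n) x<a+n))

range≡iterate : ∀ l m → range l m ≡ iterate suc l (suc m ∸ l)
range≡iterate l m = trans (List.map-applyUpTo id (λ i → l + i) _) (applyUpTo-+ l _ _ (λ _ → refl))
  where
  applyUpTo-+ : ∀ l n (f : ℕ → ℕ) → (∀ i → f i ≡ l + i) → applyUpTo f n ≡ iterate suc l n
  applyUpTo-+ l zero f f≗ = refl
  applyUpTo-+ l (suc n) f f≗ = cong₂ _∷_ (trans (f≗ 0) (+-identityʳ l))
    (applyUpTo-+ (suc l) n (λ i → f (suc i)) (λ i → trans (f≗ (suc i)) (+-suc l i)))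

∈-range⁻ : ∀ {x} l m → x ∈ range l m → l ≤ x
∈-range⁻ l m x∈ = proj₁ (∈-iterate-suc⁻ l _ (subst (_ ∈_) (range≡iterate l m) x∈))

∈-range⁺ : ∀ {x} l m → l ≤ x → x ≤ m → x ∈ range l m
∈-range⁺ {x} l m l≤x x≤m = subst (x ∈_) (sym (range≡iterate l m))
  (∈-iterate-suc⁺ l _ l≤x (subst (x <_) (sym (m+[n∸m]≡n (≤-trans l≤x (m≤n⇒m≤1+n x≤m)))) (s≤s x≤m)))

∤-between : ∀ {p a i} .{{_ : NonZero p}} → p ∣ a → a < i → i < a + p → ¬ p ∣ i
∤-between {p} {a} {i} p∣a a<i i<a+p p∣i = >⇒∤ {{>-nonZero (m<n⇒0<n∸m a<i)}} i∸a<p p∣i∸a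
  where
  i≡a+[i∸a] : i ≡ a + (i ∸ a)
  i≡a+[i∸a] = sym (m+[n∸m]≡n (<⇒≤ a<i))
  i∸a<p : i ∸ a < p
  i∸a<p = +-cancelˡ-< a (i ∸ a) p (subst (_< a + p) i≡a+[i∸a] i<a+p)
  p∣i∸a : p ∣ i ∸ a
  p∣i∸a = ∣m+n∣m⇒∣n (subst (p ∣_) i≡a+[i∸a] p∣i) p∣a

module IntervalSum {c ℓ} (R : CommutativeSemiring c ℓ) where
  private module R = CommutativeSemiring R
  open R using (Carrier; _≈_; 0#)
  open Sum R
  open import Relation.Binary.Reasoning.Setoid R.setoid

  ∑-iterate-suc-vanishing : ∀ (f : ℕ → Carrier) a {n N} → n ≤ N → (∀ i → a + n ≤ i → f i ≈ 0#) →
    ∑ f (iterate suc a N) ≈ ∑ f (iterate suc a n)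
  ∑-iterate-suc-vanishing f a {n} {N} n≤N f≈0 = begin
    ∑ f (iterate suc a N)                                    ≡⟨ cong (λ k → ∑ f (iterate suc a k)) (sym (m+[n∸m]≡n n≤N)) ⟩
    ∑ f (iterate suc a (n + (N ∸ n)))                        ≡⟨ cong (∑ f) (iterate-suc-+ a n (N ∸ n)) ⟩
    ∑ f (iterate suc a n ++ iterate suc (a + n) (N ∸ n))     ≈⟨ ∑-++ f (iterate suc a n) (iterate suc (a + n) (N ∸ n)) ⟩
    ∑ f (iterate suc a n) R.+ ∑ f (iterate suc (a + n) (N ∸ n))
      ≈⟨ R.+-congˡ (∑-zero (iterate suc (a + n) (N ∸ n)) (λ i i∈ → f≈0 i (proj₁ (∈-iterate-suc⁻ (a + n) (N ∸ n) i∈)))) ⟩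
    ∑ f (iterate suc a n) R.+ 0#                              ≈⟨ R.+-identityʳ _ ⟩
    ∑ f (iterate suc a n)                                    ∎

  ∑-multiples-block : ∀ (f : ℕ → Carrier) p a .{{_ : NonZero p}} → p ∣ a →
    ∑ (λ i → if does (p ∣? i) then f i else 0#) (iterate suc (suc a) p) ≈ f (a + p)
  ∑-multiples-block f (suc q) a p∣a = begin
    ∑ g (iterate suc (suc a) (suc q))            ≡⟨ cong (∑ g) (iterate-suc-∷ʳ (suc a) q) ⟩
    ∑ g (iterate suc (suc a) q ∷ʳ (suc a + q))   ≈⟨ ∑-∷ʳ g (iterate suc (suc a) q) (suc a + q) ⟩
    ∑ g (iterate suc (suc a) q) R.+ g (suc a + q) ≈⟨ R.+-cong (∑-zero (iterate suc (suc a) q) inner-zero) (R.reflexive last-term) ⟩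
    0# R.+ f (a + suc q)                          ≈⟨ R.+-identityˡ _ ⟩
    f (a + suc q)                                 ∎
    where
    g : ℕ → Carrier
    g i = if does (suc q ∣? i) then f i else 0#
    inner-zero : ∀ i → i ∈ iterate suc (suc a) q → g i ≈ 0#
    inner-zero i i∈ with ∈-iterate-suc⁻ (suc a) q i∈
    ... | a<i , i<a+1+q = R.reflexive (if-no (suc q ∣? i) (∤-between p∣a a<i (subst (i <_) (sym (+-suc a q)) i<a+1+q)))
    last-term : g (suc a + q) ≡ f (a + suc q)
    last-term = trans (cong g (sym (+-suc a q))) (if-yes (suc q ∣? (a + suc q)) (∣m∣n⇒∣m+n p∣a ∣-refl))

  ∑-multiples : ∀ (f : ℕ → Carrier) p .{{_ : NonZero p}} m →
    ∑ (λ d → if does (p ∣? d) then f d else 0#) (iterate suc 1 (m * p)) ≈ ∑ (λ e → f (e * p)) (iterate suc 1 m)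
  ∑-multiples f p zero = R.refl
  ∑-multiples f p (suc m) = begin
    ∑ g (iterate suc 1 (suc m * p))                             ≡⟨ cong (λ k → ∑ g (iterate suc 1 k)) (+-comm p (m * p)) ⟩
    ∑ g (iterate suc 1 (m * p + p))                             ≡⟨ cong (∑ g) (iterate-suc-+ 1 (m * p) p) ⟩
    ∑ g (iterate suc 1 (m * p) ++ iterate suc (suc (m * p)) p)  ≈⟨ ∑-++ g (iterate suc 1 (m * p)) _ ⟩
    ∑ g (iterate suc 1 (m * p)) R.+ ∑ g (iterate suc (suc (m * p)) p)
      ≈⟨ R.+-cong (∑-multiples f p m) (∑-multiples-block f p (m * p) (n∣m*n m)) ⟩
    ∑ h (iterate suc 1 m) R.+ f (m * p + p)                     ≡⟨ cong (λ k → ∑ h (iterate suc 1 m) R.+ f k) (+-comm (m * p) p) ⟩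
    ∑ h (iterate suc 1 m) R.+ h (suc m)                         ≈⟨ R.sym (∑-∷ʳ h (iterate suc 1 m) (suc m)) ⟩
    ∑ h (iterate suc 1 m ∷ʳ suc m)                              ≡⟨ cong (∑ h) (iterate-suc-∷ʳ 1 m) ⟨
    ∑ h (iterate suc 1 (suc m))                                 ∎
    where
    g h : ℕ → Carrier
    g d = if does (p ∣? d) then f d else 0#
    h e = f (e * p)

module ℕInterval = IntervalSum +-*-commutativeSemiring
module ℤInterval = IntervalSum ℤP.+-*-commutativeSemiring

∑-𝟙-≟ : ∀ {p} a n → a ≤ p → p < a + n → Σℕ.∑ (λ q → 𝟙 (q ≟ p)) (iterate suc a n) ≡ 1
∑-𝟙-≟ {p} a zero a≤p p<a+0 = ⊥-elim (<⇒≱ p<a+0 (subst (_≤ p) (sym (+-identityʳ a)) a≤p))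
∑-𝟙-≟ {p} a (suc n) a≤p p<a+n with a ≟ p
... | yes refl = cong₂ _+_ (if-yes (a ≟ a) refl) (Σℕ.∑-zero (iterate suc (suc a) n)
      (λ q q∈ → if-no (q ≟ a) (λ q≡a → <-irrefl (sym q≡a) (proj₁ (∈-iterate-suc⁻ (suc a) n q∈)))))
... | no a≢p = cong₂ _+_ (if-no (a ≟ p) a≢p) (∑-𝟙-≟ (suc a) n (≤∧≢⇒< a≤p a≢p) (subst (p <_) (+-suc a n) p<a+n))

suc-/ : ∀ n D .{{_ : NonZero D}} → suc n / D ≡ n / D + 𝟙 (D ∣? suc n)
suc-/ n D with suc (n % D) ≟ D
... | yes r+1≡D = begin
  suc n / D          ≡⟨ /-congˡ sucn≡[q+1]D ⟩
  suc q * D / D      ≡⟨ m*n/n≡m (suc q) D ⟩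
  suc q              ≡⟨ +-comm 1 q ⟩
  q + 1              ≡⟨ cong (_+_ q) (if-yes (D ∣? suc n) (divides (suc q) sucn≡[q+1]D)) ⟨
  q + 𝟙 (D ∣? suc n) ∎
  where
  open ≡-Reasoning
  q : ℕ
  q = n / D
  sucn≡[q+1]D : suc n ≡ suc q * D
  sucn≡[q+1]D = trans (cong suc (m≡m%n+[m/n]*n n D)) (cong (_+ q * D) r+1≡D)
... | no r+1≢D = begin
  suc n / D                 ≡⟨ /-congˡ sucn≡r+1+qD ⟩
  (suc r + q * D) / D       ≡⟨ +-distrib-/-∣ʳ (suc r) (n∣m*n q) ⟩
  suc r / D + q * D / D     ≡⟨ cong₂ _+_ (m<n⇒m/n≡0 r+1<D) (m*n/n≡m q D) ⟩
  q                         ≡⟨ +-identityʳ q ⟨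
  q + 0                     ≡⟨ cong (_+_ q) (if-no (D ∣? suc n) D∤sucn) ⟨
  q + 𝟙 (D ∣? suc n)        ∎
  where
  open ≡-Reasoning
  q r : ℕ
  q = n / D
  r = n % D
  sucn≡r+1+qD : suc n ≡ suc r + q * D
  sucn≡r+1+qD = cong suc (m≡m%n+[m/n]*n n D)
  r+1<D : suc r < D
  r+1<D = ≤∧≢⇒< (m%n<n n D) r+1≢D
  D∤sucn : ¬ D ∣ suc n
  D∤sucn D∣sucn = >⇒∤ r+1<D (∣m+n∣m⇒∣n (subst (D ∣_) (trans sucn≡r+1+qD (+-comm (suc r) (q * D))) D∣sucn) (n∣m*n q))

multiples : ℕ → List ℕ → ℕ
multiples d = Σℕ.∑ (λ x → 𝟙 (d ∣? x))

multiples-iterate : ∀ D .{{_ : NonZero D}} l t →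
  multiples D (iterate suc (suc l) t) + l / D ≡ (l + t) / D
multiples-iterate D l zero = cong (_/ D) (sym (+-identityʳ l))
multiples-iterate D l (suc t) = begin
  𝟙 (D ∣? suc l) + M (suc l) t + l / D      ≡⟨ +-CS.xy∙z≈y∙zx (𝟙 (D ∣? suc l)) (M (suc l) t) (l / D) ⟩
  M (suc l) t + (l / D + 𝟙 (D ∣? suc l))    ≡⟨ cong (_+_ (M (suc l) t)) (suc-/ l D) ⟨
  M (suc l) t + suc l / D                   ≡⟨ multiples-iterate D (suc l) t ⟩
  (suc l + t) / D                           ≡⟨ cong (_/ D) (+-suc l t) ⟨
  (l + suc t) / D                           ∎
  where
  open ≡-Reasoning
  M : ℕ → ℕ → ℕ
  M l t = multiples D (iterate suc (suc l) t)

-- Squarefree numbers and the Möbius function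

SquareFree : ℕ → Set
SquareFree d = ∀ k → 2 ≤ k → ¬ k * k ∣ d

squarefree?-sound : ∀ {d} → 1 ≤ d → All (λ k → ¬ k * k ∣ d) (range 2 d) → SquareFree d
squarefree?-sound {d} 1≤d all k 2≤k k*k∣d = All.lookup all (∈-range⁺ 2 d 2≤k k≤d) k*k∣d
  where
  k≤d : k ≤ d
  k≤d = ≤-trans (m≤m*n k k {{>-nonZero (≤-trans z<s 2≤k)}}) (∣⇒≤ {{>-nonZero 1≤d}} k*k∣d)

squarefree?-complete : ∀ {d} → SquareFree d → All (λ k → ¬ k * k ∣ d) (range 2 d)
squarefree?-complete {d} sf = All.tabulate (λ {k} k∈ → sf k (∈-range⁻ 2 d k∈))

squareFree? : ∀ {d} → 1 ≤ d → Dec (SquareFree d)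
squareFree? {d} 1≤d = map′ (squarefree?-sound 1≤d) squarefree?-complete (squarefree? d)

SquareFree-∣ : ∀ {m n} → m ∣ n → SquareFree n → SquareFree m
SquareFree-∣ m∣n sf k 2≤k k*k∣m = sf k 2≤k (∣-trans k*k∣m m∣n)

¬SquareFree-* : ∀ {k e} → 2 ≤ k → k ∣ e → ¬ SquareFree (e * k)
¬SquareFree-* {k} 2≤k k∣e sf = sf k 2≤k (*-monoˡ-∣ k k∣e)

prime∤⇒coprime : ∀ {p e} → Prime p → ¬ p ∣ e → Coprime e p
prime∤⇒coprime pp p∤e (i∣e , i∣p) with prime⇒irreducible pp i∣p
... | inj₁ i≡1 = i≡1
... | inj₂ refl = ⊥-elim (p∤e i∣e)

∣*prime⇒∣ : ∀ {p d m} → Prime p → ¬ p ∣ d → d ∣ m * p → d ∣ m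
∣*prime⇒∣ {p} {d} {m} pp p∤d d∣mp = coprime-divisor (prime∤⇒coprime pp p∤d) (subst (d ∣_) (*-comm m p) d∣mp)

SquareFree-*-prime : ∀ {p e} → Prime p → ¬ p ∣ e → SquareFree e → SquareFree (e * p)
SquareFree-*-prime {p} {e} pp p∤e sf k 2≤k k*k∣ep with p ∣? k
... | yes p∣k = p∤e (*-cancelʳ-∣ p {{prime⇒nonZero pp}} (∣-trans (*-pres-∣ p∣k p∣k) k*k∣ep))
... | no p∤k = sf k 2≤k (∣*prime⇒∣ pp p∤k*k k*k∣ep)
  where
  p∤k*k : ¬ p ∣ k * k
  p∤k*k p∣k*k = [ p∤k , p∤k ]′ (euclidsLemma k k pp p∣k*k)

prime∣prime⇒≡ : ∀ {p q} → Prime p → Prime q → q ∣ p → q ≡ p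
prime∣prime⇒≡ pp pq q∣p with prime⇒irreducible pp q∣p
... | inj₁ refl = ⊥-elim (¬prime[1] pq)
... | inj₂ q≡p = q≡p

ω-as-∑ : ∀ d → ω d ≡ Σℕ.∑ (λ q → 𝟙 (prime? q ×-dec q ∣? d)) (iterate suc 1 d)
ω-as-∑ d = trans (length-filter _ (range 1 d)) (cong (Σℕ.∑ _) (range≡iterate 1 d))

ω-*-prime : ∀ {p e} → Prime p → ¬ p ∣ e → 1 ≤ e → ω (e * p) ≡ suc (ω e)
ω-*-prime {p} {e} pp p∤e 1≤e = begin
  ω (e * p)                                        ≡⟨ ω-as-∑ (e * p) ⟩
  Σℕ.∑ (λ q → 𝟙 (P? (e * p) q)) (iterate suc 1 (e * p)) ≡⟨ Σℕ.∑-cong (iterate suc 1 (e * p)) (λ q _ → split q) ⟩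
  Σℕ.∑ (λ q → 𝟙 (q ≟ p) + 𝟙 (P? e q)) (iterate suc 1 (e * p))
                                                   ≡⟨ Σℕ.∑-+ (λ q → 𝟙 (q ≟ p)) (λ q → 𝟙 (P? e q)) (iterate suc 1 (e * p)) ⟩
  Σℕ.∑ (λ q → 𝟙 (q ≟ p)) (iterate suc 1 (e * p)) + Σℕ.∑ (λ q → 𝟙 (P? e q)) (iterate suc 1 (e * p))
                                                   ≡⟨ cong₂ _+_ (∑-𝟙-≟ 1 (e * p) 1≤p (s≤s p≤ep)) ∑-beyond-e ⟩
  1 + Σℕ.∑ (λ q → 𝟙 (P? e q)) (iterate suc 1 e)   ≡⟨ cong suc (ω-as-∑ e) ⟨
  suc (ω e)                                        ∎
  where
  open ≡-Reasoning
  instance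
    p≢0 : NonZero p
    p≢0 = prime⇒nonZero pp
  P? : ∀ n q → Dec (Prime q × q ∣ n)
  P? n q = prime? q ×-dec q ∣? n
  1≤p : 1 ≤ p
  1≤p = >-nonZero⁻¹ p
  p≤ep : p ≤ e * p
  p≤ep = m≤n*m p e {{>-nonZero 1≤e}}
  split : ∀ q → 𝟙 (P? (e * p) q) ≡ 𝟙 (q ≟ p) + 𝟙 (P? e q)
  split q with q ≟ p
  ... | yes refl = trans (if-yes (P? (e * q) q) (pp , n∣m*n e)) (sym (cong₂ _+_ (if-yes (q ≟ q) refl) (if-no (P? e q) (p∤e ∘ proj₂))))
  ... | no q≢p = trans (if-⇔ (mk⇔ (λ (pq , q∣ep) → pq , q∣e pq q∣ep) (λ (pq , q∣e) → pq , ∣m⇒∣m*n p q∣e)) (P? (e * p) q) (P? e q))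
                       (cong (_+ 𝟙 (P? e q)) (sym (if-no (q ≟ p) q≢p)))
    where
    q∣e : Prime q → q ∣ e * p → q ∣ e
    q∣e pq q∣ep = [ id , (λ q∣p → ⊥-elim (q≢p (prime∣prime⇒≡ pp pq q∣p))) ]′ (euclidsLemma e p pq q∣ep)
  ∑-beyond-e : Σℕ.∑ (λ q → 𝟙 (P? e q)) (iterate suc 1 (e * p)) ≡ Σℕ.∑ (λ q → 𝟙 (P? e q)) (iterate suc 1 e)
  ∑-beyond-e = ℕInterval.∑-iterate-suc-vanishing _ 1 (m≤m*n e p)
    (λ q e<q → if-no (P? e q) (>⇒∤ {{>-nonZero 1≤e}} e<q ∘ proj₂))

μ-squareFree : ∀ {d} → SquareFree d → μ d ≡ (ℤ.- (+ 1)) ℤ.^ ω d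
μ-squareFree {d} sf with squarefree? d
... | yes _ = refl
... | no ¬all = ⊥-elim (¬all (squarefree?-complete sf))

μ-¬squareFree : ∀ {d} → 1 ≤ d → ¬ SquareFree d → μ d ≡ + 0
μ-¬squareFree {d} 1≤d ¬sf with squarefree? d
... | yes all = ⊥-elim (¬sf (squarefree?-sound 1≤d all))
... | no _ = refl

μ-*-prime-∣ : ∀ {p e} → Prime p → p ∣ e → 1 ≤ e → μ (e * p) ≡ + 0
μ-*-prime-∣ {p} {e} pp p∣e 1≤e =
  μ-¬squareFree (*-mono-≤ 1≤e (>-nonZero⁻¹ p {{prime⇒nonZero pp}})) (¬SquareFree-* (nonTrivial⇒n>1 p {{prime⇒nonTrivial pp}}) p∣e)

μ-*-prime-∤ : ∀ {p e} → Prime p → ¬ p ∣ e → 1 ≤ e → μ (e * p) ≡ ℤ.- μ e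
μ-*-prime-∤ {p} {e} pp p∤e 1≤e with squareFree? 1≤e
... | yes sf = begin
  μ (e * p)                              ≡⟨ μ-squareFree (SquareFree-*-prime pp p∤e sf) ⟩
  (ℤ.- (+ 1)) ℤ.^ ω (e * p)              ≡⟨ cong ((ℤ.- (+ 1)) ℤ.^_) (ω-*-prime pp p∤e 1≤e) ⟩
  (ℤ.- (+ 1)) ℤ.* (ℤ.- (+ 1)) ℤ.^ ω e    ≡⟨ ℤP.-1*i≡-i _ ⟩
  ℤ.- ((ℤ.- (+ 1)) ℤ.^ ω e)              ≡⟨ cong ℤ.-_ (μ-squareFree sf) ⟨
  ℤ.- μ e                                ∎
  where open ≡-Reasoning
... | no ¬sf = trans (μ-¬squareFree (*-mono-≤ 1≤e (>-nonZero⁻¹ p {{prime⇒nonZero pp}})) (¬sf ∘ SquareFree-∣ (m∣m*n p)))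
                      (cong ℤ.-_ (sym (μ-¬squareFree 1≤e ¬sf)))

μ-divisor-sum-*-prime : ∀ {p m} → Prime p → 1 ≤ m →
  Σℤ.∑ (λ d → if does (d ∣? m * p) then μ d else + 0) (iterate suc 1 (m * p)) ≡ + 0
μ-divisor-sum-*-prime {p} {m} pp 1≤m = begin
  ∑ h (I (m * p))                                ≡⟨ Σℤ.∑-cong (I (m * p)) (λ d _ → if-split (p ∣? d) (h d)) ⟩
  ∑ (λ d → A d ℤ.+ B d) (I (m * p))              ≡⟨ Σℤ.∑-+ A B (I (m * p)) ⟩
  ∑ A (I (m * p)) ℤ.+ ∑ B (I (m * p))
    ≡⟨ cong₂ ℤ._+_ (ℤInterval.∑-multiples h p m) (ℤInterval.∑-iterate-suc-vanishing B 1 (m≤m*n m p) B-beyond-m) ⟩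
  ∑ (λ e → h (e * p)) (I m) ℤ.+ ∑ B (I m)
    ≡⟨ cong₂ ℤ._+_ (Σℤ.∑-cong (I m) (λ e e∈ → h-multiple e (proj₁ (∈-iterate-suc⁻ 1 m e∈)))) (Σℤ.∑-cong (I m) (λ e _ → B≡g e)) ⟩
  ∑ (λ e → ℤ.- g e) (I m) ℤ.+ ∑ g (I m)          ≡⟨ Σℤ.∑-+ (λ e → ℤ.- g e) g (I m) ⟨
  ∑ (λ e → ℤ.- g e ℤ.+ g e) (I m)                ≡⟨ Σℤ.∑-zero (I m) (λ e _ → ℤP.+-inverseˡ (g e)) ⟩
  + 0                                            ∎
  where
  open ≡-Reasoning
  open Σℤ using (∑)
  instance
    p≢0 : NonZero p
    p≢0 = prime⇒nonZero pp
  I : ℕ → List ℕ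
  I = iterate suc 1
  h A B g : ℕ → ℤ
  h d = if does (d ∣? m * p) then μ d else + 0
  A d = if does (p ∣? d) then h d else + 0
  B d = if does (p ∣? d) then + 0 else h d
  g e = if does (e ∣? m ×-dec ¬? (p ∣? e)) then μ e else + 0
  B-beyond-m : ∀ i → 1 + m ≤ i → B i ≡ + 0
  B-beyond-m i m<i with p ∣? i
  ... | yes _ = refl
  ... | no p∤i = if-no (i ∣? m * p) (>⇒∤ {{>-nonZero 1≤m}} m<i ∘ ∣*prime⇒∣ pp p∤i)
  h-multiple : ∀ e → 1 ≤ e → h (e * p) ≡ ℤ.- g e
  h-multiple e 1≤e with e ∣? m | p ∣? e
  ... | no e∤m | _ = if-no (e * p ∣? m * p) (e∤m ∘ *-cancelʳ-∣ p)
  ... | yes e∣m | yes p∣e = trans (if-yes (e * p ∣? m * p) (*-monoˡ-∣ p e∣m)) (μ-*-prime-∣ pp p∣e 1≤e)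
  ... | yes e∣m | no p∤e = trans (if-yes (e * p ∣? m * p) (*-monoˡ-∣ p e∣m)) (μ-*-prime-∤ pp p∤e 1≤e)
  B≡g : ∀ e → B e ≡ g e
  B≡g e with p ∣? e
  ... | yes p∣e = sym (if-no (e ∣? m ×-dec ¬? (yes p∣e)) (λ (_ , p∤e) → p∤e p∣e))
  ... | no p∤e = if-⇔ (mk⇔ (λ e∣mp → ∣*prime⇒∣ pp p∤e e∣mp , p∤e) (λ (e∣m , _) → ∣m⇒∣m*n p e∣m))
                      (e ∣? m * p) (e ∣? m ×-dec ¬? (no p∤e))

μ-divisor-sum : ∀ {n N} → 1 ≤ n → n ≤ N →
  Σℤ.∑ (λ d → if does (d ∣? n) then μ d else + 0) (iterate suc 1 N) ≡ + 𝟙 (n ≟ 1)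
μ-divisor-sum {n} 1≤n n≤N = trans (ℤInterval.∑-iterate-suc-vanishing _ 1 n≤N beyond-n) (up-to-n n 1≤n)
  where
  beyond-n : ∀ i → 1 + n ≤ i → (if does (i ∣? n) then μ i else + 0) ≡ + 0
  beyond-n i n<i = if-no (i ∣? n) (>⇒∤ {{>-nonZero 1≤n}} n<i)
  up-to-n : ∀ n → 1 ≤ n → Σℤ.∑ (λ d → if does (d ∣? n) then μ d else + 0) (iterate suc 1 n) ≡ + 𝟙 (n ≟ 1)
  up-to-n 1 _ = refl
  up-to-n n@(suc (suc _)) _ with factorise n
  ... | record { factors = [] ; isFactorisation = () }
  ... | record { factors = p ∷ ps ; isFactorisation = n≡p*ps ; factorsPrime = pp ∷ pps } =
    subst (λ k → Σℤ.∑ (λ d → if does (d ∣? k) then μ d else + 0) (iterate suc 1 k) ≡ + 0)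
          (trans (*-comm (product ps) p) (sym n≡p*ps))
          (μ-divisor-sum-*-prime pp (productOfPrimes≥1 pps))

-- Möbius inversion over common divisors

∣⇒>0 : ∀ {m n} → 0 < n → m ∣ n → 0 < m
∣⇒>0 {zero} 0<n 0∣n = ⊥-elim (<⇒≢ 0<n (sym (0∣⇒≡0 0∣n)))
∣⇒>0 {suc _} _ _ = z<s

gcdSet-∣ : ∀ {x} X → x ∈ X → gcdSet X ∣ x
gcdSet-∣ (y ∷ X) (here refl) = gcd[m,n]∣m y (gcdSet X)
gcdSet-∣ (y ∷ X) (there x∈X) = ∣-trans (gcd[m,n]∣n y (gcdSet X)) (gcdSet-∣ X x∈X)

∣gcdSet⇔All-∣ : ∀ {d} X → d ∣ gcdSet X ⇔ All (d ∣_) X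
∣gcdSet⇔All-∣ X = mk⇔ (λ d∣gcd → All.tabulate (λ x∈X → ∣-trans d∣gcd (gcdSet-∣ X x∈X))) (greatest X)
  where
  greatest : ∀ {d} X → All (d ∣_) X → d ∣ gcdSet X
  greatest [] [] = _ ∣0
  greatest (x ∷ X) (d∣x ∷ d∣X) = gcd-greatest d∣x (greatest X d∣X)

pos-∑ : ∀ {A : Set} (f : A → ℕ) xs → + Σℕ.∑ f xs ≡ Σℤ.∑ (λ x → + f x) xs
pos-∑ f [] = refl
pos-∑ f (x ∷ xs) = trans (ℤP.pos-+ (f x) (Σℕ.∑ f xs)) (cong (ℤ._+_ (+ f x)) (pos-∑ f xs))

-- sumCommonDiv a b f is definitionally Σℤ.∑ f (commonDivisors a b).
commonDivisors : ℕ → ℕ → List ℕ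
commonDivisors a b = filter (λ d → d ∣? a ×-dec d ∣? b) (range 1 (gcd a b))

sumCommonDiv-cong : ∀ {a b} {f g : ℕ → ℤ} → (∀ d → 1 ≤ d → d ∣ a → d ∣ b → f d ≡ g d) →
  sumCommonDiv a b f ≡ sumCommonDiv a b g
sumCommonDiv-cong {a} {b} {f} {g} f≗g = Σℤ.∑-cong _ (λ d d∈ → pointwise d (∈-filter⁻ _ d∈))
  where
  pointwise : ∀ d → d ∈ range 1 (gcd a b) × (d ∣ a × d ∣ b) → f d ≡ g d
  pointwise d (d∈ , d∣a , d∣b) = f≗g d (∈-range⁻ 1 _ d∈) d∣a d∣b

μ-common-divisor-sum : ∀ {a b n} → 1 ≤ a → n ∣ a → n ∣ b →
  sumCommonDiv a b (λ d → μ d ℤ.* + 𝟙 (d ∣? n)) ≡ + 𝟙 (n ≟ 1)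
μ-common-divisor-sum {a} {b} {n} 1≤a n∣a n∣b = begin
  sumCommonDiv a b (λ d → μ d ℤ.* + 𝟙 (d ∣? n))
    ≡⟨ Σℤ.∑-filter (λ d → d ∣? a ×-dec d ∣? b) _ (range 1 (gcd a b)) ⟩
  Σℤ.∑ (λ d → if does (d ∣? a ×-dec d ∣? b) then μ d ℤ.* + 𝟙 (d ∣? n) else + 0) (range 1 (gcd a b))
    ≡⟨ Σℤ.∑-cong (range 1 (gcd a b)) (λ d _ → pointwise d) ⟩
  Σℤ.∑ (λ d → if does (d ∣? n) then μ d else + 0) (range 1 (gcd a b))
    ≡⟨ cong (Σℤ.∑ (λ d → if does (d ∣? n) then μ d else + 0)) (range≡iterate 1 (gcd a b)) ⟩
  Σℤ.∑ (λ d → if does (d ∣? n) then μ d else + 0) (iterate suc 1 (gcd a b))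
    ≡⟨ μ-divisor-sum 1≤n (∣⇒≤ {{gcd≢0}} (gcd-greatest n∣a n∣b)) ⟩
  + 𝟙 (n ≟ 1) ∎
  where
  open ≡-Reasoning
  1≤n : 1 ≤ n
  1≤n = ∣⇒>0 1≤a n∣a
  gcd≢0 : NonZero (gcd a b)
  gcd≢0 = >-nonZero (∣⇒>0 1≤a (gcd[m,n]∣m a b))
  pointwise : ∀ d → (if does (d ∣? a ×-dec d ∣? b) then μ d ℤ.* + 𝟙 (d ∣? n) else + 0)
                    ≡ (if does (d ∣? n) then μ d else + 0)
  pointwise d with d ∣? n
  ... | yes d∣n = trans (if-yes (d ∣? a ×-dec d ∣? b) (∣-trans d∣n n∣a , ∣-trans d∣n n∣b)) (ℤP.*-identityʳ (μ d))
  ... | no _ = trans (if-cong-then (does (d ∣? a ×-dec d ∣? b)) (ℤP.*-zeroʳ (μ d))) (if-eta _)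

module GcdInversion (l₁ l₂ : ℕ) (1≤l₁ : 1 ≤ l₁) where

  isGood : (X : List ℕ) → Dec (l₁ ∈ X × l₂ ∈ X × gcdSet X ≡ 1)
  isGood X = (l₁ ∈? X) ×-dec ((l₂ ∈? X) ×-dec (gcdSet X ≟ 1))

  required : List ℕ → ℕ
  required X = 𝟙 (l₁ ∈? X) * 𝟙 (l₂ ∈? X)

  divisibleWeight : (List ℕ → ℕ) → ℕ → List ℕ → ℕ
  divisibleWeight w d X = required X * (𝟙 (all? (d ∣?_) X) * w X)

  𝟙-isGood-expansion : ∀ (w : List ℕ → ℕ) X →
    + (𝟙 (isGood X) * w X) ≡ sumCommonDiv l₁ l₂ (λ d → μ d ℤ.* + divisibleWeight w d X)
  𝟙-isGood-expansion w X with l₁ ∈? X | l₂ ∈? X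
  ... | no _ | _ = sym (Σℤ.∑-zero (commonDivisors l₁ l₂) (λ d _ → ℤP.*-zeroʳ (μ d)))
  ... | yes _ | no _ = sym (Σℤ.∑-zero (commonDivisors l₁ l₂) (λ d _ → ℤP.*-zeroʳ (μ d)))
  ... | yes l₁∈X | yes l₂∈X = begin
    + (𝟙 (gcdSet X ≟ 1) * w X)                                         ≡⟨ ℤP.pos-* (𝟙 (gcdSet X ≟ 1)) (w X) ⟩
    + 𝟙 (gcdSet X ≟ 1) ℤ.* + w X
      ≡⟨ cong (ℤ._* + w X) (μ-common-divisor-sum 1≤l₁ (gcdSet-∣ X l₁∈X) (gcdSet-∣ X l₂∈X)) ⟨
    sumCommonDiv l₁ l₂ (λ d → μ d ℤ.* + 𝟙 (d ∣? gcdSet X)) ℤ.* + w X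
      ≡⟨ Σℤ.∑-*ʳ (+ w X) (λ d → μ d ℤ.* + 𝟙 (d ∣? gcdSet X)) (commonDivisors l₁ l₂) ⟨
    sumCommonDiv l₁ l₂ (λ d → μ d ℤ.* + 𝟙 (d ∣? gcdSet X) ℤ.* + w X)
      ≡⟨ Σℤ.∑-cong (commonDivisors l₁ l₂) (λ d _ → term d) ⟩
    sumCommonDiv l₁ l₂ (λ d → μ d ℤ.* + (1 * (𝟙 (all? (d ∣?_) X) * w X))) ∎
    where
    open ≡-Reasoning
    term : ∀ d → μ d ℤ.* + 𝟙 (d ∣? gcdSet X) ℤ.* + w X ≡ μ d ℤ.* + (1 * (𝟙 (all? (d ∣?_) X) * w X))
    term d = begin
      μ d ℤ.* + 𝟙 (d ∣? gcdSet X) ℤ.* + w X         ≡⟨ ℤP.*-assoc (μ d) (+ 𝟙 (d ∣? gcdSet X)) (+ w X) ⟩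
      μ d ℤ.* (+ 𝟙 (d ∣? gcdSet X) ℤ.* + w X)       ≡⟨ cong (μ d ℤ.*_) (ℤP.pos-* (𝟙 (d ∣? gcdSet X)) (w X)) ⟨
      μ d ℤ.* + (𝟙 (d ∣? gcdSet X) * w X)
        ≡⟨ cong (λ k → μ d ℤ.* + (k * w X)) (if-⇔ (∣gcdSet⇔All-∣ X) (d ∣? gcdSet X) (all? (d ∣?_) X)) ⟩
      μ d ℤ.* + (𝟙 (all? (d ∣?_) X) * w X)          ≡⟨ cong (λ k → μ d ℤ.* + k) (*-identityˡ (𝟙 (all? (d ∣?_) X) * w X)) ⟨
      μ d ℤ.* + (1 * (𝟙 (all? (d ∣?_) X) * w X))    ∎

  gcd-inversion : ∀ (w : List ℕ → ℕ) Xs →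
    + Σℕ.∑ (λ X → 𝟙 (isGood X) * w X) Xs ≡ sumCommonDiv l₁ l₂ (λ d → μ d ℤ.* + Σℕ.∑ (divisibleWeight w d) Xs)
  gcd-inversion w Xs = begin
    + Σℕ.∑ (λ X → 𝟙 (isGood X) * w X) Xs                        ≡⟨ pos-∑ _ Xs ⟩
    Σℤ.∑ (λ X → + (𝟙 (isGood X) * w X)) Xs                      ≡⟨ Σℤ.∑-cong Xs (λ X _ → 𝟙-isGood-expansion w X) ⟩
    Σℤ.∑ (λ X → sumCommonDiv l₁ l₂ (λ d → F d X)) Xs
      ≡⟨ Σℤ.∑-swap (λ X d → F d X) Xs (commonDivisors l₁ l₂) ⟩
    sumCommonDiv l₁ l₂ (λ d → Σℤ.∑ (F d) Xs)
      ≡⟨ Σℤ.∑-cong (commonDivisors l₁ l₂) (λ d _ → pull-out d) ⟩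
    sumCommonDiv l₁ l₂ (λ d → μ d ℤ.* + Σℕ.∑ (divisibleWeight w d) Xs) ∎
    where
    open ≡-Reasoning
    F : ℕ → List ℕ → ℤ
    F d X = μ d ℤ.* + divisibleWeight w d X
    pull-out : ∀ d → Σℤ.∑ (F d) Xs ≡ μ d ℤ.* + Σℕ.∑ (divisibleWeight w d) Xs
    pull-out d = trans (Σℤ.∑-*ˡ (μ d) _ Xs) (cong (μ d ℤ.*_) (sym (pos-∑ (divisibleWeight w d) Xs)))

-- Counting sets of multiples

∈-sublists⁻ : ∀ {A : Set} {x : A} {Y} V → Y ∈ sublists V → x ∈ Y → x ∈ V
∈-sublists⁻ [] (here refl) ()
∈-sublists⁻ (v ∷ V) Y∈ x∈Y with ∈-++⁻ (map (v ∷_) (sublists V)) Y∈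
... | inj₂ Y∈V = there (∈-sublists⁻ V Y∈V x∈Y)
... | inj₁ Y∈vV with ∈-map⁻ (v ∷_) Y∈vV | x∈Y
...   | Y′ , _ , refl | here x≡v = here x≡v
...   | Y′ , Y′∈ , refl | there x∈Y′ = there (∈-sublists⁻ V Y′∈ x∈Y′)

record Pascal (b : ℕ → ℕ → ℕ) : Set where
  field
    zeroʳ : ∀ n → b (suc n) 0 ≡ b n 0
    sucʳ : ∀ n j → b (suc n) (suc j) ≡ b n j + b n (suc j)

  𝟙-zeroʳ : (P? : Dec P) → ∀ n → 𝟙 P? * 0 + b n 0 ≡ b (𝟙 P? + n) 0
  𝟙-zeroʳ (yes _) n = sym (zeroʳ n)
  𝟙-zeroʳ (no _) n = refl

  𝟙-sucʳ : (P? : Dec P) → ∀ n j → 𝟙 P? * b n j + b n (suc j) ≡ b (𝟙 P? + n) (suc j)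
  𝟙-sucʳ (yes _) n j = trans (cong (_+ b n (suc j)) (+-identityʳ (b n j))) (sym (sucʳ n j))
  𝟙-sucʳ (no _) n j = refl

-- Requiring one more element in every set raises every size by one.
shift : (ℕ → ℕ → ℕ) → ℕ → ℕ → ℕ
shift b n zero = 0
shift b n (suc j) = b n j

Pascal-shift : ∀ {b} → Pascal b → Pascal (shift b)
Pascal-shift {b} pb = record { zeroʳ = λ _ → refl ; sucʳ = sucʳ }
  where
  sucʳ : ∀ n j → shift b (suc n) (suc j) ≡ shift b n j + shift b n (suc j)
  sucʳ n zero = Pascal.zeroʳ pb n
  sucʳ n (suc j) = Pascal.sucʳ pb n j

Pascal-C : Pascal _C_
Pascal-C = record { zeroʳ = λ _ → refl ; sucʳ = λ n j → sym (nCk+nC[k+1]≡[n+1]C[k+1] n j) }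

module DivisibleSublists (d : ℕ) where

  weight : (List ℕ → ℕ) → (ℕ → ℕ) → List ℕ → ℕ
  weight Φ ψ Y = Φ Y * (𝟙 (all? (d ∣?_) Y) * ψ (length Y))

  count : (List ℕ → ℕ) → (ℕ → ℕ) → List ℕ → ℕ
  count Φ ψ V = Σℕ.∑ (weight Φ ψ) (sublists V)

  count-zero : ∀ Φ V → count Φ (λ _ → 0) V ≡ 0
  count-zero Φ V = Σℕ.∑-zero (sublists V) (λ Y _ → trans (cong (Φ Y *_) (*-zeroʳ (𝟙 (all? (d ∣?_) Y)))) (*-zeroʳ (Φ Y)))

  count-∷ : ∀ {Φ} ψ a V → (∀ Y → Φ (a ∷ Y) ≡ Φ Y) →
    count Φ ψ (a ∷ V) ≡ 𝟙 (d ∣? a) * count Φ (ψ ∘ suc) V + count Φ ψ V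
  count-∷ {Φ} ψ a V Φ-inv = begin
    count Φ ψ (a ∷ V)                                              ≡⟨ Σℕ.∑-sublists-∷ (weight Φ ψ) a V ⟩
    Σℕ.∑ (λ Y → weight Φ ψ (a ∷ Y)) (sublists V) + count Φ ψ V     ≡⟨ cong (_+ count Φ ψ V) head-terms ⟩
    𝟙 (d ∣? a) * count Φ (ψ ∘ suc) V + count Φ ψ V                 ∎
    where
    open ≡-Reasoning
    head-term : ∀ Y → weight Φ ψ (a ∷ Y) ≡ 𝟙 (d ∣? a) * weight Φ (ψ ∘ suc) Y
    head-term Y = begin
      Φ (a ∷ Y) * (𝟙 (all? (d ∣?_) (a ∷ Y)) * ψ (suc (length Y)))
        ≡⟨ cong₂ (λ u v → u * (v * ψ (suc (length Y)))) (Φ-inv Y) (𝟙-× (d ∣? a) (all? (d ∣?_) Y)) ⟩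
      Φ Y * (𝟙 (d ∣? a) * 𝟙 (all? (d ∣?_) Y) * ψ (suc (length Y)))
        ≡⟨ cong (Φ Y *_) (*-assoc (𝟙 (d ∣? a)) _ _) ⟩
      Φ Y * (𝟙 (d ∣? a) * (𝟙 (all? (d ∣?_) Y) * ψ (suc (length Y))))
        ≡⟨ x∙yz≈y∙xz (Φ Y) (𝟙 (d ∣? a)) _ ⟩
      𝟙 (d ∣? a) * weight Φ (ψ ∘ suc) Y ∎
    head-terms : Σℕ.∑ (λ Y → weight Φ ψ (a ∷ Y)) (sublists V) ≡ 𝟙 (d ∣? a) * count Φ (ψ ∘ suc) V
    head-terms = trans (Σℕ.∑-cong (sublists V) (λ Y _ → head-term Y)) (Σℕ.∑-*ˡ (𝟙 (d ∣? a)) _ (sublists V))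

  count-required-head : ∀ {Φ Φ′} ψ l V → ¬ l ∈ V → d ∣ l →
    (∀ Y → Φ (l ∷ Y) ≡ Φ′ Y) → (∀ Y → ¬ l ∈ Y → Φ Y ≡ 0) →
    count Φ ψ (l ∷ V) ≡ count Φ′ (ψ ∘ suc) V
  count-required-head {Φ} {Φ′} ψ l V l∉V d∣l Φ-head Φ-vanish = begin
    count Φ ψ (l ∷ V)                                              ≡⟨ Σℕ.∑-sublists-∷ (weight Φ ψ) l V ⟩
    Σℕ.∑ (λ Y → weight Φ ψ (l ∷ Y)) (sublists V) + count Φ ψ V
      ≡⟨ cong₂ _+_ (Σℕ.∑-cong (sublists V) (λ Y _ → head-term Y)) (Σℕ.∑-zero (sublists V) without-l) ⟩
    count Φ′ (ψ ∘ suc) V + 0                                        ≡⟨ +-identityʳ _ ⟩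
    count Φ′ (ψ ∘ suc) V                                            ∎
    where
    open ≡-Reasoning
    head-term : ∀ Y → weight Φ ψ (l ∷ Y) ≡ weight Φ′ (ψ ∘ suc) Y
    head-term Y = cong₂ (λ u v → u * (v * ψ (suc (length Y)))) (Φ-head Y)
      (trans (𝟙-× (d ∣? l) (all? (d ∣?_) Y)) (trans (cong (_* 𝟙 (all? (d ∣?_) Y)) (if-yes (d ∣? l) d∣l)) (*-identityˡ _)))
    without-l : ∀ Y → Y ∈ sublists V → weight Φ ψ Y ≡ 0
    without-l Y Y∈ = cong (_* _) (Φ-vanish Y (l∉V ∘ ∈-sublists⁻ V Y∈))

  count-++-pow : ∀ {Φ} A V → (∀ a → a ∈ A → ∀ Y → Φ (a ∷ Y) ≡ Φ Y) →
    count Φ (λ _ → 1) (A ++ V) ≡ 2 ^ multiples d A * count Φ (λ _ → 1) V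
  count-++-pow [] V _ = sym (+-identityʳ _)
  count-++-pow {Φ} (a ∷ A) V Φ-inv = begin
    count Φ (λ _ → 1) (a ∷ A ++ V)                       ≡⟨ count-∷ (λ _ → 1) a (A ++ V) (Φ-inv a (here refl)) ⟩
    𝟙 (d ∣? a) * count Φ (λ _ → 1) (A ++ V) + count Φ (λ _ → 1) (A ++ V)
                                                          ≡⟨ 𝟙-double (d ∣? a) _ ⟩
    2 ^ 𝟙 (d ∣? a) * count Φ (λ _ → 1) (A ++ V)
      ≡⟨ cong (2 ^ 𝟙 (d ∣? a) *_) (count-++-pow A V (λ a′ → Φ-inv a′ ∘ there)) ⟩
    2 ^ 𝟙 (d ∣? a) * (2 ^ multiples d A * count Φ (λ _ → 1) V)
      ≡⟨ *-assoc (2 ^ 𝟙 (d ∣? a)) _ _ ⟨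
    2 ^ 𝟙 (d ∣? a) * 2 ^ multiples d A * count Φ (λ _ → 1) V
      ≡⟨ cong (_* count Φ (λ _ → 1) V) (^-distribˡ-+-* 2 (𝟙 (d ∣? a)) _) ⟨
    2 ^ multiples d (a ∷ A) * count Φ (λ _ → 1) V         ∎
    where
    open ≡-Reasoning
    𝟙-double : (P? : Dec P) → ∀ x → 𝟙 P? * x + x ≡ 2 ^ 𝟙 P? * x
    𝟙-double (yes _) x = +-comm (1 * x) x
    𝟙-double (no _) x = sym (+-identityʳ x)

  count-++-pascal : ∀ {Φ b} → Pascal b → ∀ A V n → (∀ a → a ∈ A → ∀ Y → Φ (a ∷ Y) ≡ Φ Y) →
    (∀ j → count Φ (λ k → 𝟙 (k ≟ j)) V ≡ b n j) →
    ∀ j → count Φ (λ k → 𝟙 (k ≟ j)) (A ++ V) ≡ b (multiples d A + n) j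
  count-++-pascal pb [] V n _ base j = base j
  count-++-pascal {Φ} {b} pb (a ∷ A) V n Φ-inv base j = begin
    count Φ (δ j) (a ∷ A ++ V)
      ≡⟨ count-∷ (δ j) a (A ++ V) (Φ-inv a (here refl)) ⟩
    𝟙 (d ∣? a) * count Φ (δ j ∘ suc) (A ++ V) + count Φ (δ j) (A ++ V)
      ≡⟨ step j ⟩
    b (𝟙 (d ∣? a) + (multiples d A + n)) j
      ≡⟨ cong (λ k → b k j) (+-assoc (𝟙 (d ∣? a)) (multiples d A) n) ⟨
    b (multiples d (a ∷ A) + n) j ∎
    where
    open ≡-Reasoning
    δ : ℕ → ℕ → ℕ
    δ j k = 𝟙 (k ≟ j)
    IH : ∀ j → count Φ (δ j) (A ++ V) ≡ b (multiples d A + n) j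
    IH = count-++-pascal pb A V n (λ a′ → Φ-inv a′ ∘ there) base
    step : ∀ j → 𝟙 (d ∣? a) * count Φ (δ j ∘ suc) (A ++ V) + count Φ (δ j) (A ++ V) ≡ b (𝟙 (d ∣? a) + (multiples d A + n)) j
    step zero = trans (cong₂ (λ u v → 𝟙 (d ∣? a) * u + v) (count-zero Φ (A ++ V)) (IH zero)) (Pascal.𝟙-zeroʳ pb (d ∣? a) _)
    step (suc j) = trans (cong₂ (λ u v → 𝟙 (d ∣? a) * u + v) (IH j) (IH (suc j))) (Pascal.𝟙-sucʳ pb (d ∣? a) _ j)

  count-all-pow : ∀ V → count (λ _ → 1) (λ _ → 1) V ≡ 2 ^ multiples d V
  count-all-pow V = begin
    count (λ _ → 1) (λ _ → 1) V                    ≡⟨ cong (count (λ _ → 1) (λ _ → 1)) (List.++-identityʳ V) ⟨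
    count (λ _ → 1) (λ _ → 1) (V ++ [])            ≡⟨ count-++-pow {λ _ → 1} V [] (λ _ _ _ → refl) ⟩
    2 ^ multiples d V * 1                          ≡⟨ *-identityʳ _ ⟩
    2 ^ multiples d V                              ∎
    where open ≡-Reasoning

  count-all-binom : ∀ V j → count (λ _ → 1) (λ k → 𝟙 (k ≟ j)) V ≡ multiples d V C j
  count-all-binom V j = begin
    count (λ _ → 1) (λ k → 𝟙 (k ≟ j)) V            ≡⟨ cong (count (λ _ → 1) (λ k → 𝟙 (k ≟ j))) (List.++-identityʳ V) ⟨
    count (λ _ → 1) (λ k → 𝟙 (k ≟ j)) (V ++ [])    ≡⟨ count-++-pascal {λ _ → 1} Pascal-C V [] 0 (λ _ _ _ → refl) empty j ⟩
    (multiples d V + 0) C j                        ≡⟨ cong (_C j) (+-identityʳ _) ⟩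
    multiples d V C j                              ∎
    where
    open ≡-Reasoning
    empty : ∀ j → count (λ _ → 1) (λ k → 𝟙 (k ≟ j)) [] ≡ 0 C j
    empty zero = refl
    empty (suc j) = refl

module TwoIntervals (l₁ m₁ l₂ m₂ : ℕ)
  (1≤l₁ : 1 ≤ l₁) (l₁≤m₁ : l₁ ≤ m₁) (m₁<l₂ : m₁ < l₂) (l₂≤m₂ : l₂ ≤ m₂) where

  A B W U : List ℕ
  A = iterate suc (suc l₁) (m₁ ∸ l₁)
  B = iterate suc (suc l₂) (m₂ ∸ l₂)
  W = A ++ l₂ ∷ B
  U = range l₁ m₁ ++ range l₂ m₂

  range≡∷ : ∀ {l m} → l ≤ m → range l m ≡ l ∷ iterate suc (suc l) (m ∸ l)
  range≡∷ {l} {m} l≤m = trans (range≡iterate l m) (cong (iterate suc l) (+-∸-assoc 1 l≤m))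

  U≡l₁∷W : U ≡ l₁ ∷ W
  U≡l₁∷W = cong₂ _++_ (range≡∷ l₁≤m₁) (range≡∷ l₂≤m₂)

  l₁<l₂ : l₁ < l₂
  l₁<l₂ = ≤-<-trans l₁≤m₁ m₁<l₂

  A<l₂ : ∀ {a} → a ∈ A → a < l₂
  A<l₂ a∈A = ≤-<-trans (subst (_ ≤_) (m+[n∸m]≡n l₁≤m₁) (≤-pred (proj₂ (∈-iterate-suc⁻ (suc l₁) (m₁ ∸ l₁) a∈A))))
                       m₁<l₂

  B>l₂ : ∀ {b} → b ∈ B → l₂ < b
  B>l₂ b∈B = proj₁ (∈-iterate-suc⁻ (suc l₂) (m₂ ∸ l₂) b∈B)

  l₁∉W : ¬ l₁ ∈ W
  l₁∉W l₁∈W with ∈-++⁻ A l₁∈W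
  ... | inj₁ l₁∈A = <-irrefl refl (proj₁ (∈-iterate-suc⁻ (suc l₁) (m₁ ∸ l₁) l₁∈A))
  ... | inj₂ (here l₁≡l₂) = <-irrefl l₁≡l₂ l₁<l₂
  ... | inj₂ (there l₁∈B) = <-asym l₁<l₂ (B>l₂ l₁∈B)

  l₂∉B : ¬ l₂ ∈ B
  l₂∉B l₂∈B = <-irrefl refl (B>l₂ l₂∈B)

  multiples-exponent : ∀ {d} → 1 ≤ d → d ∣ l₁ →
    multiples d A + multiples d B ≡ (m₁ div d + m₂ div d) ∸ ((l₁ + l₂) div d)
  multiples-exponent {suc d′} _ d∣l₁ = begin
    MA + MB                                        ≡⟨ m+n∸n≡m (MA + MB) (l₁ / D + l₂ / D) ⟨
    MA + MB + (l₁ / D + l₂ / D) ∸ (l₁ / D + l₂ / D)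
      ≡⟨ cong₂ _∸_ (trans (+-CS.interchange MA MB (l₁ / D) (l₂ / D))
                          (cong₂ _+_ (multiples-up-to l₁≤m₁) (multiples-up-to l₂≤m₂)))
                   (sym (+-distrib-/-∣ˡ l₂ d∣l₁)) ⟩
    (m₁ / D + m₂ / D) ∸ ((l₁ + l₂) / D)           ∎
    where
    open ≡-Reasoning
    D MA MB : ℕ
    D = suc d′
    MA = multiples D A
    MB = multiples D B
    multiples-up-to : ∀ {l m} → l ≤ m → multiples D (iterate suc (suc l) (m ∸ l)) + l / D ≡ m / D
    multiples-up-to {l} l≤m = trans (multiples-iterate D l _) (cong (_/ D) (m+[n∸m]≡n l≤m))

  open GcdInversion l₁ l₂ 1≤l₁ public using (isGood; required; divisibleWeight; gcd-inversion)

  module _ (d : ℕ) (d∣l₁ : d ∣ l₁) (d∣l₂ : d ∣ l₂) where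
    open DivisibleSublists d

    has-l₂ : List ℕ → ℕ
    has-l₂ Y = 𝟙 (l₂ ∈? Y)

    count-U : ∀ ψ → Σℕ.∑ (divisibleWeight (λ X → ψ (length X)) d) (sublists U) ≡ count has-l₂ (ψ ∘ suc) W
    count-U ψ = trans (cong (count required ψ) U≡l₁∷W) (count-required-head ψ l₁ W l₁∉W d∣l₁ head vanish)
      where
      head : ∀ Y → required (l₁ ∷ Y) ≡ has-l₂ Y
      head Y = trans (cong (_* 𝟙 (l₂ ∈? l₁ ∷ Y)) (if-yes (l₁ ∈? l₁ ∷ Y) {1} {0} (here refl)))
                     (trans (*-identityˡ (𝟙 (l₂ ∈? l₁ ∷ Y))) (𝟙-∈-∷-≢ Y (λ l₂≡l₁ → <-irrefl (sym l₂≡l₁) l₁<l₂)))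
      vanish : ∀ Y → ¬ l₁ ∈ Y → required Y ≡ 0
      vanish Y l₁∉Y = cong (_* 𝟙 (l₂ ∈? Y)) (if-no (l₁ ∈? Y) {1} {0} l₁∉Y)

    A-invariant : ∀ a → a ∈ A → ∀ Y → has-l₂ (a ∷ Y) ≡ has-l₂ Y
    A-invariant a a∈A Y = 𝟙-∈-∷-≢ Y (λ l₂≡a → <-irrefl (sym l₂≡a) (A<l₂ a∈A))

    count-l₂∷B : ∀ ψ → count has-l₂ ψ (l₂ ∷ B) ≡ count (λ _ → 1) (ψ ∘ suc) B
    count-l₂∷B ψ = count-required-head ψ l₂ B l₂∉B d∣l₂
      (λ Y → if-yes (l₂ ∈? l₂ ∷ Y) (here refl)) (λ Y l₂∉Y → if-no (l₂ ∈? Y) l₂∉Y)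

    count-pow : Σℕ.∑ (divisibleWeight (λ _ → 1) d) (sublists U) ≡ 2 ^ (multiples d A + multiples d B)
    count-pow = begin
      Σℕ.∑ (divisibleWeight (λ _ → 1) d) (sublists U)          ≡⟨ count-U (λ _ → 1) ⟩
      count has-l₂ (λ _ → 1) (A ++ l₂ ∷ B)                    ≡⟨ count-++-pow A (l₂ ∷ B) A-invariant ⟩
      2 ^ multiples d A * count has-l₂ (λ _ → 1) (l₂ ∷ B)
        ≡⟨ cong (2 ^ multiples d A *_) (trans (count-l₂∷B (λ _ → 1)) (count-all-pow B)) ⟩
      2 ^ multiples d A * 2 ^ multiples d B                     ≡⟨ ^-distribˡ-+-* 2 (multiples d A) _ ⟨
      2 ^ (multiples d A + multiples d B)                       ∎
      where open ≡-Reasoning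

    count-binom : ∀ k → Σℕ.∑ (divisibleWeight (λ X → 𝟙 (length X ≟ suc k)) d) (sublists U)
                        ≡ shift _C_ (multiples d A + multiples d B) k
    count-binom k = trans (count-U (λ n → 𝟙 (n ≟ suc k)))
      (count-++-pascal (Pascal-shift Pascal-C) A (l₂ ∷ B) (multiples d B) A-invariant base k)
      where
      base : ∀ j → count has-l₂ (λ n → 𝟙 (n ≟ j)) (l₂ ∷ B) ≡ shift _C_ (multiples d B) j
      base zero = trans (count-l₂∷B (λ n → 𝟙 (n ≟ 0))) (count-zero (λ _ → 1) B)
      base (suc j) = trans (count-l₂∷B (λ n → 𝟙 (n ≟ suc j))) (count-all-binom B j)

shift-C≡binomℤ : ∀ n k → shift _C_ n k ≡ binomℤ n (+ suc k ℤ.- + 2)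
shift-C≡binomℤ n zero = refl
shift-C≡binomℤ n (suc k) = refl

lemma3 : (l₁ m₁ l₂ m₂ k : ℕ) → 1 ≤ l₁ → l₁ ≤ m₁ → m₁ < l₂ → l₂ ≤ m₂ → 1 ≤ k →
    (+ h2 l₁ m₁ l₂ m₂
      ≡ sumCommonDiv l₁ l₂ (λ d →
          μ d ℤ.* + (2 ^ ((m₁ div d + m₂ div d) ∸ ((l₁ + l₂) div d)))))
    × (+ h2k l₁ m₁ l₂ m₂ k
      ≡ sumCommonDiv l₁ l₂ (λ d →
          μ d ℤ.* + binomℤ ((m₁ div d + m₂ div d) ∸ ((l₁ + l₂) div d)) (+ k ℤ.- + 2)))
lemma3 l₁ m₁ l₂ m₂ (suc k) 1≤l₁ l₁≤m₁ m₁<l₂ l₂≤m₂ _ =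
  (begin
    + h2 l₁ m₁ l₂ m₂
      ≡⟨ cong +_ (trans (length-filter isGood (sublists U)) (Σℕ.∑-cong (sublists U) (λ X _ → sym (*-identityʳ _)))) ⟩
    + Σℕ.∑ (λ X → 𝟙 (isGood X) * 1) (sublists U)
      ≡⟨ gcd-inversion (λ _ → 1) (sublists U) ⟩
    sumCommonDiv l₁ l₂ (λ d → μ d ℤ.* + Σℕ.∑ (divisibleWeight (λ _ → 1) d) (sublists U))
      ≡⟨ sumCommonDiv-cong (λ d 1≤d d∣l₁ d∣l₂ → cong (λ n → μ d ℤ.* + n)
           (trans (count-pow d d∣l₁ d∣l₂) (cong (2 ^_) (multiples-exponent 1≤d d∣l₁)))) ⟩
    sumCommonDiv l₁ l₂ (λ d → μ d ℤ.* + (2 ^ ((m₁ div d + m₂ div d) ∸ ((l₁ + l₂) div d)))) ∎)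
  ,
  (begin
    + h2k l₁ m₁ l₂ m₂ (suc k)
      ≡⟨ cong +_ (length-filter-filter isGood (λ X → length X ≟ suc k) (sublists U)) ⟩
    + Σℕ.∑ (λ X → 𝟙 (isGood X) * 𝟙 (length X ≟ suc k)) (sublists U)
      ≡⟨ gcd-inversion (λ X → 𝟙 (length X ≟ suc k)) (sublists U) ⟩
    sumCommonDiv l₁ l₂ (λ d → μ d ℤ.* + Σℕ.∑ (divisibleWeight (λ X → 𝟙 (length X ≟ suc k)) d) (sublists U))
      ≡⟨ sumCommonDiv-cong (λ d 1≤d d∣l₁ d∣l₂ → cong (λ n → μ d ℤ.* + n)
           (trans (count-binom d d∣l₁ d∣l₂ k)
             (trans (cong (λ n → shift _C_ n k) (multiples-exponent 1≤d d∣l₁)) (shift-C≡binomℤ _ k)))) ⟩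
    sumCommonDiv l₁ l₂ (λ d → μ d ℤ.* + binomℤ ((m₁ div d + m₂ div d) ∸ ((l₁ + l₂) div d)) (+ suc k ℤ.- + 2)) ∎)
  where
  open TwoIntervals l₁ m₁ l₂ m₂ 1≤l₁ l₁≤m₁ m₁<l₂ l₂≤m₂
  open ≡-Reasoning
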